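{- Let $S=\{i_1,i_2,\ldots,i_s\}\subseteq[n+1]$ with $i_1<i_2<\cdots<i_s$ be an $(n+1)$-admissible set. For $1\le \ell\le s$ let $S_{i_\ell}=\{i_1,\ldots,i_{\ell-1},i_\ell-1,i_{\ell+1}-1,\ldots,i_s-1\}$ and $\widehat{S}_{i_\ell}=\{i_1,\ldots,i_{\ell-1},i_{\ell+1}-1,\ldots,i_s-1\}$ (i.e. $S_{i_\ell}$ with the element $i_\ell-1$ removed). Then for every integer $q\geq\max(S)$, \[|\mathcal{P}_S(q+1)|=2|\mathcal{P}_S(q)|+2\sum_{\ell=1}^{s}|\mathcal{P}_{S_{i_\ell}}(q)|+\sum_{\ell=1}^{s}|\mathcal{P}_{\widehat{S}_{i_\ell}}(q)|.\]
   Context: For a positive integer $n$, $[n]=\{1,\dots,n\}$ and $\mathfrak{S}_n$ is the symmetric group, with $\pi\in\mathfrak{S}_n$ written in one-line notation $\pi=\pi_1\pi_2\cdots\pi_n$. A permutation $\pi$ has a peak at index $i$ (necessarily $2\le i\le n-1$) if $\pi_{i-1}<\pi_i>\pi_{i+1}$; $\mathcal{P}(\pi)$ is the set of indices at which $\pi$ has a peak. For a set $T$ of positive integers, $\mathcal{P}_T(q)=\{\pi\in\mathfrak{S}_q:\mathcal{P}(\pi)=T\}$ (possibly empty). A set $S$ is called $n$-admissible if $\mathcal{P}_S(n)\neq\emptyset$. -}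

module Defs where

open import Data.Nat using (ℕ; zero; suc; _+_; _∸_; _≤_; _<_; _≤?_; _<?_)
open import Data.Nat.Properties using (_≟_)
open import Data.List using (List; []; _∷_; length; map; concatMap; filter; upTo; take; drop; _++_)
open import Data.List.Relation.Unary.All using (All; all?)
open import Data.List.Membership.DecPropositional _≟_ using (_∈_; _∈?_)
open import Data.List.Relation.Unary.Unique.DecPropositional _≟_ using (Unique; unique?)
open import Data.Product using (_×_; Σ; ∃)
open import Relation.Binary.PropositionalEquality using (_≡_)
open import Relation.Nullary using (Dec; _×-dec_)

range1 : ℕ → List ℕ
range1 q = map suc (upTo q)

-- A permutation π ∈ 𝔖_q in one-line notation π₁ π₂ ⋯ π_q is a list of
-- length q whose entries lie in [q] and are pairwise distinct.
IsPerm : ℕ → List ℕ → Set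
IsPerm q π = (length π ≡ q) × All (λ x → (1 ≤ x) × (x ≤ q)) π × Unique π

isPerm? : (q : ℕ) → (π : List ℕ) → Dec (IsPerm q π)
isPerm? q π = (length π ≟ q) ×-dec (all? (λ x → (1 ≤? x) ×-dec (x ≤? q)) π ×-dec unique? π)

-- π_i (1-based indexing; value 0 outside the range 1..length π)
entry : List ℕ → ℕ → ℕ
entry [] i = 0
entry (x ∷ π) zero = 0
entry (x ∷ π) (suc zero) = x
entry (x ∷ π) (suc (suc i)) = entry π (suc i)

HasPeak : List ℕ → ℕ → Set
HasPeak π i = (2 ≤ i) × (i + 1 ≤ length π) ×
              (entry π (i ∸ 1) < entry π i) × (entry π (i + 1) < entry π i)

hasPeak? : (π : List ℕ) → (i : ℕ) → Dec (HasPeak π i)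
hasPeak? π i = (2 ≤? i) ×-dec ((i + 1 ≤? length π) ×-dec
               ((entry π (i ∸ 1) <? entry π i) ×-dec (entry π (i + 1) <? entry π i)))

peakSet : List ℕ → List ℕ
peakSet π = filter (hasPeak? π) (upTo (suc (length π)))

SameSet : List ℕ → List ℕ → Set
SameSet A B = All (_∈ B) A × All (_∈ A) B

sameSet? : (A B : List ℕ) → Dec (SameSet A B)
sameSet? A B = all? (_∈? B) A ×-dec all? (_∈? A) B

words : ℕ → ℕ → List (List ℕ)
words zero q = [] ∷ []
words (suc k) q = concatMap (λ w → map (_∷ w) (range1 q)) (words k q)

InPT : List ℕ → ℕ → List ℕ → Set
InPT T q π = IsPerm q π × SameSet (peakSet π) T

inPT? : (T : List ℕ) (q : ℕ) (π : List ℕ) → Dec (InPT T q π)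
inPT? T q π = isPerm? q π ×-dec sameSet? (peakSet π) T

-- |𝒫_T(q)| : every permutation of [q] occurs exactly once among the words
-- of length q over [q], so this counts {π ∈ 𝔖_q : 𝒫(π) = T}.
countPT : List ℕ → ℕ → ℕ
countPT T q = length (filter (inPT? T q) (words q q))

Admissible : ℕ → List ℕ → Set
Admissible m S = ∃ λ π → InPT S m π

data StrictlyIncreasing : List ℕ → Set where
  inc-[] : StrictlyIncreasing []
  inc-[x] : ∀ {x} → StrictlyIncreasing (x ∷ [])
  inc-∷ : ∀ {x y l} → x < y → StrictlyIncreasing (y ∷ l) → StrictlyIncreasing (x ∷ y ∷ l)

-- For S = (i₁,…,i_s) and 1 ≤ ℓ ≤ s:
-- S_{i_ℓ} = {i₁,…,i_{ℓ-1}, i_ℓ - 1, i_{ℓ+1} - 1, …, i_s - 1}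
shiftSet : List ℕ → ℕ → List ℕ
shiftSet S ℓ = take (ℓ ∸ 1) S ++ map (_∸ 1) (drop (ℓ ∸ 1) S)

shiftSetHat : List ℕ → ℕ → List ℕ
shiftSetHat S ℓ = take (ℓ ∸ 1) S ++ map (_∸ 1) (drop ℓ S)

-- Every permutation of [q + 1] arises exactly once by inserting q + 1 into a permutation σ of [q].
-- Inserting the maximum destroys the peaks of σ next to it, moves the peaks to its right one place
-- further, and creates a peak at its own position unless it is put at an end.  Hence the result has
-- peak set S only if q + 1 is put first (and 𝒫(σ) = S_{i₁}), last (and 𝒫(σ) = S), or at position
-- i_ℓ.  In the last case σ has, besides the shifted peaks of S, either no peak at i_ℓ - 1 and i_ℓ,
-- or one at i_ℓ - 1, or one at i_ℓ (never both, since peaks are not adjacent): 𝒫(σ) is Ŝ_{i_ℓ},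
-- S_{i_ℓ} or S_{i_{ℓ+1}}, where S_{i_{s+1}} = S.  Summing over σ and ℓ, the terms S_{i_{ℓ+1}}
-- together with S_{i₁} telescope into the S_{i_ℓ} together with S.

module Submission where

open import Defs

import Axiom.UniquenessOfIdentityProofs as UIP
open import Data.Bool.Base using (if_then_else_)
open import Data.Empty using (⊥-elim)
open import Data.List.Base
  using (List; []; _∷_; _++_; [_]; length; map; concatMap; cartesianProductWith; filter; upTo; applyUpTo; take; drop)
open import Data.List.Properties
  using ( ≡-dec; ∷-injective; ++-assoc; ++-identityʳ; take-all; drop-all; take++drop≡id; applyUpTo-∷ʳ
        ; length-++-sucʳ; length-++-≤ˡ; length-map; length-upTo; length-filter
        ; map-applyUpTo; map-cong-local; map-++; map-∘)
open import Data.List.Membership.Propositional using (_∈_; _∉_)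
open import Data.List.Membership.Propositional.Properties
  using ( ∈-filter⁺; ∈-filter⁻; ∈-map⁺; ∈-map⁻; ∈-++⁺ˡ; ∈-++⁺ʳ; ∈-++⁻; ∈-upTo⁺; ∈-upTo⁻; ∈-∃++
        ; ∈-cartesianProductWith⁺; ∈-cartesianProductWith⁻)
import Data.List.Membership.DecPropositional as DecMembership
import Data.List.Membership.Setoid.Properties as SetoidMembership
open import Data.List.Relation.Binary.BagAndSetEquality using (∼bag⇒↭)
open import Data.List.Relation.Binary.Permutation.Propositional using (_↭_; ↭⇒↭ₛ)
open import Data.List.Relation.Binary.Permutation.Propositional.Properties using (↭-length; map⁺; shift)
open import Data.List.Relation.Unary.All as All using (All; []; _∷_)
open import Data.List.Relation.Unary.All.Properties using () renaming (map⁺ to All-map⁺)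
open import Data.List.Relation.Unary.AllPairs as AllPairs using (AllPairs)
open import Data.List.Relation.Unary.AllPairs.Properties using () renaming (map⁺ to AllPairs-map⁺)
open import Data.List.Relation.Unary.Any using (here; there)
open import Data.List.Relation.Unary.Linked using (Linked; []; [-]; _∷_)
open import Data.List.Relation.Unary.Linked.Properties using (Linked⇒AllPairs)
open import Data.List.Relation.Unary.Unique.Propositional using (Unique; []; _∷_)
import Data.List.Relation.Unary.Unique.Propositional.Properties as Unique
open import Data.Nat.Base
open import Data.Nat.ListAction using (sum)
open import Data.Nat.ListAction.Properties using (sum-++; sum-↭)
open import Data.Nat.Properties
open import Algebra.Properties.CommutativeSemigroup +-commutativeSemigroup using (interchange)
open import Data.Nat.Solver using (module +-*-Solver)
open import Data.Product.Base using (_×_; _,_; proj₁; proj₂)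
open import Data.Product.Function.NonDependent.Propositional using (_×-⇔_)
open import Data.Sum.Base using (_⊎_; inj₁; inj₂; map₂; [_,_]′)
open import Function.Base using (_∘_; id; case_of_)
open import Function.Bundles using (_⇔_; mk⇔; mk↔ₛ′; Equivalence)
open import Function.Properties.Equivalence using () renaming (refl to ⇔-refl; sym to ⇔-sym; trans to ⇔-trans)
import Function.Related.Propositional as Related
open import Relation.Binary.Definitions using (DecidableEquality)
open import Relation.Binary.PropositionalEquality hiding ([_])
open import Data.List.Relation.Binary.Permutation.Setoid.Properties (setoid ℕ) using (Unique-resp-↭)
open import Relation.Nullary.Decidable using (Dec; yes; no; does; does-⇔; _×-dec_; ¬?) renaming (map to Dec-map)
open import Relation.Nullary.Negation using (¬_; contradiction)
open import Relation.Unary using (Irrelevant; Decidable)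

private
  variable
    A B C : Set

𝟙 : Dec A → ℕ
𝟙 a? = if does a? then 1 else 0

𝟙-cong : A ⇔ B → (a? : Dec A) (b? : Dec B) → 𝟙 a? ≡ 𝟙 b?
𝟙-cong A⇔B a? b? = cong (if_then 1 else 0) (does-⇔ A⇔B a? b?)

𝟙-¬ : ¬ A → (a? : Dec A) → 𝟙 a? ≡ 0
𝟙-¬ ¬a (yes a) = contradiction a ¬a
𝟙-¬ ¬a (no _)  = refl

𝟙-split₃ : (c? : Dec C) (a? : Dec A) (b? : Dec B) → ¬ (A × B) →
  𝟙 c? ≡ 𝟙 (c? ×-dec ¬? a? ×-dec ¬? b?) + 𝟙 (c? ×-dec a? ×-dec ¬? b?) + 𝟙 (c? ×-dec ¬? a? ×-dec b?)
𝟙-split₃ (no _)  _        _        _    = refl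
𝟙-split₃ (yes _) (yes a)  (yes b)  ¬a×b = contradiction (a , b) ¬a×b
𝟙-split₃ (yes _) (yes _)  (no _)   _    = refl
𝟙-split₃ (yes _) (no _)   (yes _)  _    = refl
𝟙-split₃ (yes _) (no _)   (no _)   _    = refl

length-filter≡sum-𝟙 : {P : A → Set} (P? : Decidable P) (xs : List A) →
                      length (filter P? xs) ≡ sum (map (𝟙 ∘ P?) xs)
length-filter≡sum-𝟙 P? []       = refl
length-filter≡sum-𝟙 P? (x ∷ xs) with P? x
... | yes _ = cong suc (length-filter≡sum-𝟙 P? xs)
... | no  _ = length-filter≡sum-𝟙 P? xs

sum-map-cong : {f g : A → ℕ} {xs : List A} → All (λ x → f x ≡ g x) xs → sum (map f xs) ≡ sum (map g xs)
sum-map-cong = cong sum ∘ map-cong-local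

sum-map-+ : (f g : A → ℕ) (xs : List A) →
            sum (map (λ x → f x + g x) xs) ≡ sum (map f xs) + sum (map g xs)
sum-map-+ f g []       = refl
sum-map-+ f g (x ∷ xs) = trans (cong (f x + g x +_) (sum-map-+ f g xs))
                               (interchange (f x) (g x) _ _)

sum-map-*ˡ : (k : ℕ) (f : A → ℕ) (xs : List A) → sum (map (λ x → k * f x) xs) ≡ k * sum (map f xs)
sum-map-*ˡ k f []       = sym (*-zeroʳ k)
sum-map-*ˡ k f (x ∷ xs) = trans (cong (k * f x +_) (sum-map-*ˡ k f xs)) (sym (*-distribˡ-+ k (f x) _))

sum-map-zero : (xs : List A) → sum (map (λ _ → 0) xs) ≡ 0
sum-map-zero []       = refl
sum-map-zero (_ ∷ xs) = sum-map-zero xs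

sum-map-sum-comm : (f : A → B → ℕ) (xs : List A) (ys : List B) →
                   sum (map (λ x → sum (map (f x) ys)) xs) ≡ sum (map (λ y → sum (map (λ x → f x y) xs)) ys)
sum-map-sum-comm f []       ys = sym (sum-map-zero ys)
sum-map-sum-comm f (x ∷ xs) ys = trans (cong (sum (map (f x) ys) +_) (sum-map-sum-comm f xs ys))
                                       (sym (sum-map-+ (f x) (λ y → sum (map (λ x → f x y) xs)) ys))

sum-map-cartesianProductWith : (h : C → ℕ) (f : A → B → C) (xs : List A) (ys : List B) →
  sum (map h (cartesianProductWith f xs ys)) ≡ sum (map (λ x → sum (map (h ∘ f x) ys)) xs)
sum-map-cartesianProductWith h f []       ys = refl
sum-map-cartesianProductWith h f (x ∷ xs) ys = begin
  sum (map h (map (f x) ys ++ cartesianProductWith f xs ys))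
    ≡⟨ cong sum (map-++ h (map (f x) ys) _) ⟩
  sum (map h (map (f x) ys) ++ map h (cartesianProductWith f xs ys))
    ≡⟨ sum-++ (map h (map (f x) ys)) _ ⟩
  sum (map h (map (f x) ys)) + sum (map h (cartesianProductWith f xs ys))
    ≡⟨ cong₂ _+_ (cong sum (sym (map-∘ ys))) (sum-map-cartesianProductWith h f xs ys) ⟩
  sum (map (λ x → sum (map (h ∘ f x) ys)) (x ∷ xs))
    ∎
  where open ≡-Reasoning

sum-map-filter : {P : A → Set} (P? : Decidable P) (g : A → ℕ) {xs : List A} →
                 All (λ x → ¬ P x → g x ≡ 0) xs → sum (map g (filter P? xs)) ≡ sum (map g xs)
sum-map-filter P? g []                     = refl
sum-map-filter P? g {x ∷ xs} (g≡0 ∷ g≡0s) with P? x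
... | yes _  = cong (g x +_) (sum-map-filter P? g g≡0s)
... | no ¬Px = trans (sum-map-filter P? g g≡0s) (cong (_+ sum (map g xs)) (sym (g≡0 ¬Px)))

module _ (_≟_ : DecidableEquality A) where

  ∈-irrelevant : {xs : List A} → Unique xs → Irrelevant (_∈ xs)
  ∈-irrelevant = SetoidMembership.unique⇒irrelevant (setoid _) (UIP.Decidable⇒UIP.≡-irrelevant _≟_)

  unique-sameElements⇒↭ : {xs ys : List A} → Unique xs → Unique ys → (∀ {z} → z ∈ xs ⇔ z ∈ ys) → xs ↭ ys
  unique-sameElements⇒↭ u v eq = ∼bag⇒↭ (mk↔ₛ′ (Equivalence.to eq) (Equivalence.from eq)
    (λ _ → ∈-irrelevant v _ _) (λ _ → ∈-irrelevant u _ _))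

  open DecMembership _≟_ using (_∈?_)

  unique-⊆⇒length-≤ : {xs ys : List A} → Unique xs → Unique ys → (∀ {z} → z ∈ xs → z ∈ ys) →
                      length xs ≤ length ys
  unique-⊆⇒length-≤ {xs} {ys} u v xs⊆ys = begin
    length xs                    ≡⟨ ↭-length (unique-sameElements⇒↭ u (Unique.filter⁺ (_∈? xs) v) same) ⟩
    length (filter (_∈? xs) ys) ≤⟨ length-filter (_∈? xs) ys ⟩
    length ys                    ∎
    where
    open ≤-Reasoning
    same : ∀ {z} → z ∈ xs ⇔ z ∈ filter (_∈? xs) ys
    same = mk⇔ (λ z∈xs → ∈-filter⁺ (_∈? xs) (xs⊆ys z∈xs) z∈xs) (proj₂ ∘ ∈-filter⁻ (_∈? xs) {xs = ys})

  sum-map-support : {xs ys : List A} (g : A → ℕ) → Unique xs → Unique ys → (∀ {z} → z ∈ ys → z ∈ xs) →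
                    All (λ z → z ∉ ys → g z ≡ 0) xs → sum (map g xs) ≡ sum (map g ys)
  sum-map-support {xs} {ys} g u v ys⊆xs off-ys = begin
    sum (map g xs)                   ≡⟨ sum-map-filter (_∈? ys) g off-ys ⟨
    sum (map g (filter (_∈? ys) xs)) ≡⟨ sum-↭ (map⁺ g (unique-sameElements⇒↭ (Unique.filter⁺ (_∈? ys) u) v same)) ⟩
    sum (map g ys)                   ∎
    where
    open ≡-Reasoning
    same : ∀ {z} → z ∈ filter (_∈? ys) xs ⇔ z ∈ ys
    same = mk⇔ (proj₂ ∘ ∈-filter⁻ (_∈? ys) {xs = xs}) (λ z∈ys → ∈-filter⁺ (_∈? ys) (ys⊆xs z∈ys) z∈ys)

Unique-map-local : {f : A → B} {xs : List A} → (∀ {x y} → x ∈ xs → y ∈ xs → f x ≡ f y → x ≡ y) →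
                   Unique xs → Unique (map f xs)
Unique-map-local f-inj []           = []
Unique-map-local f-inj (x∉xs ∷ uxs) =
  All-map⁺ (All.tabulate (λ y∈xs fx≡fy → All.lookup x∉xs y∈xs (f-inj (here refl) (there y∈xs) fx≡fy)))
  ∷ Unique-map-local (λ x∈ y∈ → f-inj (there x∈) (there y∈)) uxs

Unique-cartesianProductWith-local : {f : A → B → C} {xs : List A} {ys : List B} →
  (∀ {a a' b b'} → a ∈ xs → a' ∈ xs → b ∈ ys → b' ∈ ys → f a b ≡ f a' b' → a ≡ a' × b ≡ b') →
  Unique xs → Unique ys → Unique (cartesianProductWith f xs ys)
Unique-cartesianProductWith-local                      f-inj []           uys = []
Unique-cartesianProductWith-local {f = f} {x ∷ xs} {ys} f-inj (x∉xs ∷ uxs) uys =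
  Unique.++⁺ (Unique-map-local (λ b∈ b'∈ → proj₂ ∘ f-inj (here refl) (here refl) b∈ b'∈) uys)
             (Unique-cartesianProductWith-local (λ a∈ a'∈ → f-inj (there a∈) (there a'∈)) uxs uys)
             disjoint
  where
  disjoint : ∀ {v} → ¬ (v ∈ map (f x) ys × v ∈ cartesianProductWith f xs ys)
  disjoint (v∈row , v∈rest) with ∈-map⁻ (f x) v∈row | ∈-cartesianProductWith⁻ f xs ys v∈rest
  ... | b , b∈ys , refl | a , b' , a∈xs , b'∈ys , fxb≡fab' =
    All.lookup x∉xs a∈xs (proj₁ (f-inj (here refl) (there a∈xs) b∈ys b'∈ys fxb≡fab'))

-- insertAt j x ys puts x at position j counted from 0, so that x becomes entry suc j.
insertAt : ℕ → A → List A → List A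
insertAt zero    x ys       = x ∷ ys
insertAt (suc j) x []       = [ x ]
insertAt (suc j) x (y ∷ ys) = y ∷ insertAt j x ys

length-insertAt : (j : ℕ) (x : A) (ys : List A) → length (insertAt j x ys) ≡ suc (length ys)
length-insertAt zero    x ys       = refl
length-insertAt (suc j) x []       = refl
length-insertAt (suc j) x (y ∷ ys) = cong suc (length-insertAt j x ys)

∈-insertAt⁻ : (j : ℕ) {x z : A} (ys : List A) → z ∈ insertAt j x ys → z ≡ x ⊎ z ∈ ys
∈-insertAt⁻ zero    ys       (here z≡x)   = inj₁ z≡x
∈-insertAt⁻ zero    ys       (there z∈ys) = inj₂ z∈ys
∈-insertAt⁻ (suc j) []       (here z≡x)   = inj₁ z≡x
∈-insertAt⁻ (suc j) (y ∷ ys) (here z≡y)   = inj₂ (here z≡y)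
∈-insertAt⁻ (suc j) (y ∷ ys) (there z∈)   = map₂ there (∈-insertAt⁻ j ys z∈)

All-insertAt : {P : A → Set} (j : ℕ) {x : A} {ys : List A} → P x → All P ys → All P (insertAt j x ys)
All-insertAt zero    px pys         = px ∷ pys
All-insertAt (suc j) px []          = px ∷ []
All-insertAt (suc j) px (py ∷ pys)  = py ∷ All-insertAt j px pys

Unique-insertAt : (j : ℕ) {x : A} {ys : List A} → x ∉ ys → Unique ys → Unique (insertAt j x ys)
Unique-insertAt zero    x∉ys uys = All.tabulate (λ y∈ys x≡y → x∉ys (subst (_∈ _) (sym x≡y) y∈ys)) ∷ uys
Unique-insertAt (suc j) {ys = []}     x∉ys uys = [] ∷ []
Unique-insertAt (suc j) {x} {y ∷ ys} x∉ys (y∉ys ∷ uys) =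
  All.tabulate y≢ ∷ Unique-insertAt j (x∉ys ∘ there) uys
  where
  y≢ : ∀ {z} → z ∈ insertAt j x ys → y ≢ z
  y≢ z∈ y≡z with ∈-insertAt⁻ j ys z∈
  ... | inj₁ z≡x  = x∉ys (here (trans (sym z≡x) (sym y≡z)))
  ... | inj₂ z∈ys = All.lookup y∉ys z∈ys y≡z

insertAt-injective : (j j' : ℕ) {x : A} {ys ys' : List A} → x ∉ ys → x ∉ ys' →
  j ≤ length ys → j' ≤ length ys' → insertAt j x ys ≡ insertAt j' x ys' → j ≡ j' × ys ≡ ys'
insertAt-injective zero    zero    _    _     _       _        refl = refl , refl
insertAt-injective zero    (suc j') {ys' = y' ∷ _} _ x∉ys' _ _ eq =
  contradiction (here (proj₁ (∷-injective eq))) x∉ys'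
insertAt-injective (suc j) zero    {ys = y ∷ _} x∉ys _ _ _ eq =
  contradiction (here (sym (proj₁ (∷-injective eq)))) x∉ys
insertAt-injective (suc j) (suc j') {ys = y ∷ ys} {y' ∷ ys'} x∉ys x∉ys' (s≤s j≤) (s≤s j'≤) eq
  with refl , eq' ← ∷-injective eq
  with refl , refl ← insertAt-injective j j' (x∉ys ∘ there) (x∉ys' ∘ there) j≤ j'≤ eq'
  = refl , refl

insertAt-length-++ : (ys : List A) {x : A} {zs : List A} → insertAt (length ys) x (ys ++ zs) ≡ ys ++ x ∷ zs
insertAt-length-++ []       = refl
insertAt-length-++ (y ∷ ys) = cong (y ∷_) (insertAt-length-++ ys)

Unique-delete : (ys : List ℕ) {x : ℕ} {zs : List ℕ} → Unique (ys ++ x ∷ zs) → x ∉ ys ++ zs × Unique (ys ++ zs)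
Unique-delete ys {x} {zs} u with x∉ ∷ u' ← Unique-resp-↭ (↭⇒↭ₛ (shift x ys zs)) u =
  (λ x∈ → All.lookup x∉ x∈ refl) , u'

concatMap-map≡cartesianProductWith : (f : A → B → C) (xs : List A) (ys : List B) →
  concatMap (λ x → map (f x) ys) xs ≡ cartesianProductWith f xs ys
concatMap-map≡cartesianProductWith f []       ys = refl
concatMap-map≡cartesianProductWith f (x ∷ xs) ys =
  cong (map (f x) ys ++_) (concatMap-map≡cartesianProductWith f xs ys)

∈-range1⁻ : {q x : ℕ} → x ∈ range1 q → 1 ≤ x × x ≤ q
∈-range1⁻ x∈ with y , y∈ , refl ← ∈-map⁻ suc x∈ = s≤s z≤n , ∈-upTo⁻ y∈

∈-range1⁺ : {q x : ℕ} → 1 ≤ x × x ≤ q → x ∈ range1 q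
∈-range1⁺ {x = suc y} (_ , y<q) = ∈-map⁺ suc (∈-upTo⁺ y<q)

Unique-range1 : (q : ℕ) → Unique (range1 q)
Unique-range1 q = Unique.map⁺ suc-injective (Unique.upTo⁺ q)

length-range1 : (q : ℕ) → length (range1 q) ≡ q
length-range1 q = trans (length-map suc (upTo q)) (length-upTo q)

words-suc : (k q : ℕ) → words (suc k) q ≡ cartesianProductWith (λ w x → x ∷ w) (words k q) (range1 q)
words-suc k q = concatMap-map≡cartesianProductWith (λ w x → x ∷ w) (words k q) (range1 q)

∈-words⁻ : (k q : ℕ) {w : List ℕ} → w ∈ words k q → length w ≡ k × All (λ x → 1 ≤ x × x ≤ q) w
∈-words⁻ zero    q (here refl) = refl , []
∈-words⁻ (suc k) q w∈ with v , x , v∈ , x∈ , refl ← ∈-cartesianProductWith⁻ _ (words k q) (range1 q)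
                                                     (subst (_ ∈_) (words-suc k q) w∈) =
  let |v|≡k , v-bounded = ∈-words⁻ k q v∈ in cong suc |v|≡k , ∈-range1⁻ x∈ ∷ v-bounded

∈-words⁺ : (k q : ℕ) {w : List ℕ} → length w ≡ k → All (λ x → 1 ≤ x × x ≤ q) w → w ∈ words k q
∈-words⁺ zero    q {[]}    _    _                    = here refl
∈-words⁺ (suc k) q {x ∷ w} |w|≡ (x-bounded ∷ w-bounded) =
  subst (_ ∈_) (sym (words-suc k q))
    (∈-cartesianProductWith⁺ _ (∈-words⁺ k q (suc-injective |w|≡) w-bounded) (∈-range1⁺ x-bounded))

Unique-words : (k q : ℕ) → Unique (words k q)
Unique-words zero    q = [] ∷ []
Unique-words (suc k) q = subst Unique (sym (words-suc k q))
  (Unique.cartesianProductWith⁺ _ (λ eq → let x≡ , w≡ = ∷-injective eq in w≡ , x≡)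
    (Unique-words k q) (Unique-range1 q))

perms : ℕ → List (List ℕ)
perms zero    = [ [] ]
perms (suc q) = cartesianProductWith (λ σ j → insertAt j (suc q) σ) (perms q) (upTo (suc q))

suc∉perm : {q : ℕ} {σ : List ℕ} → IsPerm q σ → suc q ∉ σ
suc∉perm (_ , bounded , _) suc-q∈σ = 1+n≰n (proj₂ (All.lookup bounded suc-q∈σ))

IsPerm-insertAt : {q : ℕ} (j : ℕ) {σ : List ℕ} → IsPerm q σ → IsPerm (suc q) (insertAt j (suc q) σ)
IsPerm-insertAt {q} j {σ} σ-perm@(|σ|≡q , bounded , uσ) =
  trans (length-insertAt j (suc q) σ) (cong suc |σ|≡q) ,
  All-insertAt j (s≤s z≤n , ≤-refl) (All.map (λ (1≤x , x≤q) → 1≤x , m≤n⇒m≤1+n x≤q) bounded) ,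
  Unique-insertAt j (suc∉perm σ-perm) uσ

IsPerm-perms : (q : ℕ) {σ : List ℕ} → σ ∈ perms q → IsPerm q σ
IsPerm-perms zero    (here refl) = refl , [] , []
IsPerm-perms (suc q) π∈ with σ , j , σ∈ , _ , refl ← ∈-cartesianProductWith⁻ _ (perms q) (upTo (suc q)) π∈ =
  IsPerm-insertAt j (IsPerm-perms q σ∈)

max∈perm : {q : ℕ} {π : List ℕ} → IsPerm (suc q) π → suc q ∈ π
max∈perm {q} {π} (|π|≡ , bounded , uπ) with suc q ∈? π
  where open DecMembership _≟_ using (_∈?_)
... | yes suc-q∈π = suc-q∈π
... | no  suc-q∉π = ⊥-elim (1+n≰n (begin
      suc q              ≡⟨ |π|≡ ⟨
      length π           ≤⟨ unique-⊆⇒length-≤ _≟_ uπ (Unique-range1 q) π⊆[q] ⟩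
      length (range1 q)  ≡⟨ length-range1 q ⟩
      q                  ∎))
  where
  open ≤-Reasoning
  π⊆[q] : ∀ {z} → z ∈ π → z ∈ range1 q
  π⊆[q] {z} z∈π with 1≤z , z≤1+q ← All.lookup bounded z∈π with m≤n⇒m<n∨m≡n z≤1+q
  ... | inj₁ z≤q  = ∈-range1⁺ (1≤z , ≤-pred z≤q)
  ... | inj₂ refl = contradiction z∈π suc-q∉π

IsPerm-delete : {q : ℕ} (ys : List ℕ) {zs : List ℕ} → IsPerm (suc q) (ys ++ suc q ∷ zs) → IsPerm q (ys ++ zs)
IsPerm-delete {q} ys {zs} (|π|≡ , bounded , uπ) with q∉ , u ← Unique-delete ys uπ =
  suc-injective (trans (sym (length-++-sucʳ ys (suc q) zs)) |π|≡) ,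
  All.tabulate bound , u
  where
  bound : ∀ {z} → z ∈ ys ++ zs → 1 ≤ z × z ≤ q
  bound {z} z∈ with 1≤z , z≤1+q ← All.lookup bounded ([ ∈-++⁺ˡ , ∈-++⁺ʳ ys ∘ there ]′ (∈-++⁻ ys z∈))
                with m≤n⇒m<n∨m≡n z≤1+q
  ... | inj₁ z≤q  = 1≤z , ≤-pred z≤q
  ... | inj₂ refl = contradiction z∈ q∉

∈-perms : (q : ℕ) {π : List ℕ} → IsPerm q π → π ∈ perms q
∈-perms zero    {[]} _ = here refl
∈-perms (suc q) {π} π-perm with ys , zs , refl ← ∈-∃++ (max∈perm π-perm) =
  subst (_∈ perms (suc q)) (insertAt-length-++ ys)
    (∈-cartesianProductWith⁺ _ (∈-perms q (IsPerm-delete ys π-perm)) (∈-upTo⁺ (s≤s |ys|≤q)))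
  where
  |ys|≤q : length ys ≤ q
  |ys|≤q = subst (length ys ≤_) (proj₁ (IsPerm-delete ys π-perm)) (length-++-≤ˡ ys)

Unique-perms : (q : ℕ) → Unique (perms q)
Unique-perms zero    = [] ∷ []
Unique-perms (suc q) = Unique-cartesianProductWith-local insertion-injective (Unique-perms q) (Unique.upTo⁺ (suc q))
  where
  insertion-injective : ∀ {σ σ' j j'} → σ ∈ perms q → σ' ∈ perms q → j ∈ upTo (suc q) → j' ∈ upTo (suc q) →
                        insertAt j (suc q) σ ≡ insertAt j' (suc q) σ' → σ ≡ σ' × j ≡ j'
  insertion-injective {j = j} {j'} σ∈ σ'∈ j∈ j'∈ eq
    with σ-perm@(|σ|≡q , _) ← IsPerm-perms q σ∈ | σ'-perm@(|σ'|≡q , _) ← IsPerm-perms q σ'∈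
    with refl , refl ← insertAt-injective j j' (suc∉perm σ-perm) (suc∉perm σ'-perm)
                         (subst (j ≤_) (sym |σ|≡q) (≤-pred (∈-upTo⁻ j∈)))
                         (subst (j' ≤_) (sym |σ'|≡q) (≤-pred (∈-upTo⁻ j'∈))) eq
    = refl , refl

countPT≡sum-perms : (T : List ℕ) (q : ℕ) → countPT T q ≡ sum (map (𝟙 ∘ inPT? T q) (perms q))
countPT≡sum-perms T q = begin
  length (filter (inPT? T q) (words q q)) ≡⟨ ↭-length (unique-sameElements⇒↭ (≡-dec _≟_)
                                               (Unique.filter⁺ (inPT? T q) (Unique-words q q))
                                               (Unique.filter⁺ (inPT? T q) (Unique-perms q)) same) ⟩
  length (filter (inPT? T q) (perms q))   ≡⟨ length-filter≡sum-𝟙 (inPT? T q) (perms q) ⟩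
  sum (map (𝟙 ∘ inPT? T q) (perms q))     ∎
  where
  open ≡-Reasoning
  same : ∀ {π} → π ∈ filter (inPT? T q) (words q q) ⇔ π ∈ filter (inPT? T q) (perms q)
  same = mk⇔
    (λ π∈ → let _ , π∈T = ∈-filter⁻ (inPT? T q) {xs = words q q} π∈
            in ∈-filter⁺ (inPT? T q) (∈-perms q (proj₁ π∈T)) π∈T)
    (λ π∈ → let _ , π∈T@((|π|≡ , bounded , _) , _) = ∈-filter⁻ (inPT? T q) {xs = perms q} π∈
            in ∈-filter⁺ (inPT? T q) (∈-words⁺ q q |π|≡ bounded) π∈T)

countPT-suc : (T : List ℕ) (q : ℕ) → countPT T (suc q)
  ≡ sum (map (λ σ → sum (map (λ j → 𝟙 (inPT? T (suc q) (insertAt j (suc q) σ))) (upTo (suc q)))) (perms q))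
countPT-suc T q = trans (countPT≡sum-perms T (suc q))
  (sum-map-cartesianProductWith (𝟙 ∘ inPT? T (suc q)) (λ σ j → insertAt j (suc q) σ) (perms q) (upTo (suc q)))

sum-perms≡sum-countPT : (f : ℕ → List ℕ) (q : ℕ) (L : List ℕ) →
  sum (map (λ σ → sum (map (λ ℓ → 𝟙 (inPT? (f ℓ) q σ)) L)) (perms q)) ≡ sum (map (λ ℓ → countPT (f ℓ) q) L)
sum-perms≡sum-countPT f q L = trans (sum-map-sum-comm (λ σ ℓ → 𝟙 (inPT? (f ℓ) q σ)) (perms q) L)
  (sum-map-cong {xs = L} (All.tabulate (λ {ℓ} _ → sym (countPT≡sum-perms (f ℓ) q))))

entry-zero : (π : List ℕ) → entry π 0 ≡ 0
entry-zero []      = refl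
entry-zero (_ ∷ _) = refl

entry-≤ : {q : ℕ} (π : List ℕ) (i : ℕ) → All (_≤ q) π → entry π i ≤ q
entry-≤ []      i                 _              = z≤n
entry-≤ (x ∷ π) zero              _              = z≤n
entry-≤ (x ∷ π) (suc zero)        (x≤q ∷ _)      = x≤q
entry-≤ (x ∷ π) (suc (suc i))     (_ ∷ π≤q)      = entry-≤ π (suc i) π≤q

entry-insertAt-≤ : (j : ℕ) {x : ℕ} {σ : List ℕ} (i : ℕ) → i ≤ j → j ≤ length σ →
                   entry (insertAt j x σ) i ≡ entry σ i
entry-insertAt-≤ j       {σ = σ} zero           _         _          =
  trans (entry-zero (insertAt j _ σ)) (sym (entry-zero σ))
entry-insertAt-≤ (suc j) {σ = y ∷ σ} (suc zero)    _         _          = refl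
entry-insertAt-≤ (suc j) {σ = y ∷ σ} (suc (suc i)) (s≤s i≤j) (s≤s j≤|σ|) =
  entry-insertAt-≤ j (suc i) i≤j j≤|σ|

entry-insertAt-suc : (j : ℕ) {x : ℕ} {σ : List ℕ} → j ≤ length σ → entry (insertAt j x σ) (suc j) ≡ x
entry-insertAt-suc zero    {σ = σ}     _          = refl
entry-insertAt-suc (suc j) {σ = y ∷ σ} (s≤s j≤|σ|) = entry-insertAt-suc j j≤|σ|

entry-insertAt-> : (j : ℕ) {x : ℕ} {σ : List ℕ} (i : ℕ) → j ≤ i →
                   entry (insertAt j x σ) (suc (suc i)) ≡ entry σ (suc i)
entry-insertAt-> zero    {σ = σ}     i       _         = refl
entry-insertAt-> (suc j) {σ = []}    (suc i) _         = refl
entry-insertAt-> (suc j) {σ = y ∷ σ} (suc i) (s≤s j≤i) = entry-insertAt-> j i j≤i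

<-cong : {a a' b b' : ℕ} → a ≡ a' → b ≡ b' → (a < b) ⇔ (a' < b')
<-cong refl refl = ⇔-refl

HasPeak-local : {π σ : List ℕ} {i k : ℕ} → (2 ≤ i ⇔ 2 ≤ k) → (i + 1 ≤ length π ⇔ k + 1 ≤ length σ) →
  entry π (i ∸ 1) ≡ entry σ (k ∸ 1) → entry π i ≡ entry σ k → entry π (i + 1) ≡ entry σ (k + 1) →
  HasPeak π i ⇔ HasPeak σ k
HasPeak-local interior inside left top right = interior ×-⇔ inside ×-⇔ <-cong left top ×-⇔ <-cong right top

no-peak-at-0 : (π : List ℕ) → ¬ HasPeak π 0
no-peak-at-0 π (() , _)

no-peak-at-1 : (π : List ℕ) → ¬ HasPeak π 1
no-peak-at-1 π (s≤s () , _)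

no-peak-beyond : (π : List ℕ) {i : ℕ} → length π ≤ i → ¬ HasPeak π i
no-peak-beyond π {i} |π|≤i (_ , i+1≤|π| , _) =
  1+n≰n (≤-trans (subst (_≤ length π) (+-comm i 1) i+1≤|π|) |π|≤i)

no-adjacent-peaks : (π : List ℕ) {i : ℕ} → ¬ (HasPeak π i × HasPeak π (suc i))
no-adjacent-peaks π {i} ((_ , _ , _ , π[i+1]<π[i]) , (_ , _ , π[i]<π[i+1] , _)) =
  <-asym π[i]<π[i+1] (subst (λ k → entry π k < entry π i) (+-comm i 1) π[i+1]<π[i])

module PeaksOfInsertedMaximum {σ : List ℕ} {x j : ℕ} (j≤|σ| : j ≤ length σ) (σ<x : ∀ i → entry σ i < x) where

  private
    π : List ℕ
    π = insertAt j x σ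

    |π|≡ : length π ≡ suc (length σ)
    |π|≡ = length-insertAt j x σ

  peak-below : (i : ℕ) → i < j → HasPeak π i ⇔ HasPeak σ i
  peak-below i i<j = HasPeak-local {π} {σ} (⇔-refl)
    (mk⇔ (λ _ → ≤-trans i+1≤j j≤|σ|) (λ _ → subst (i + 1 ≤_) (sym |π|≡) (m≤n⇒m≤1+n (≤-trans i+1≤j j≤|σ|))))
    (entry-insertAt-≤ j (i ∸ 1) (≤-trans (m∸n≤m i 1) (<⇒≤ i<j)) j≤|σ|)
    (entry-insertAt-≤ j i (<⇒≤ i<j) j≤|σ|)
    (entry-insertAt-≤ j (i + 1) i+1≤j j≤|σ|)
    where
    i+1≤j : i + 1 ≤ j
    i+1≤j = subst (_≤ j) (+-comm 1 i) i<j

  no-peak-before : ¬ HasPeak π j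
  no-peak-before (_ , _ , _ , π[j+1]<π[j]) = <-asym π[j+1]<π[j] (begin-strict
    entry π j      ≡⟨ entry-insertAt-≤ j j ≤-refl j≤|σ| ⟩
    entry σ j      <⟨ σ<x j ⟩
    x              ≡⟨ entry-insertAt-suc j j≤|σ| ⟨
    entry π (suc j) ≡⟨ cong (entry π) (+-comm 1 j) ⟩
    entry π (j + 1) ∎)
    where open ≤-Reasoning

  peak-at : 1 ≤ j → j < length σ → HasPeak π (suc j)
  peak-at 1≤j j<|σ| = s≤s 1≤j , subst₂ _≤_ (+-comm 1 (suc j)) (sym |π|≡) (s≤s j<|σ|) ,
    subst₂ _<_ (sym (entry-insertAt-≤ j j ≤-refl j≤|σ|)) (sym (entry-insertAt-suc j j≤|σ|)) (σ<x j) ,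
    subst₂ _<_ (sym (trans (cong (entry π) (+-comm (suc j) 1)) (entry-insertAt-> j j ≤-refl)))
               (sym (entry-insertAt-suc j j≤|σ|)) (σ<x (suc j))

  no-peak-after : ¬ HasPeak π (suc (suc j))
  no-peak-after (_ , _ , x<π[j+2] , _) = <-asym x<π[j+2] (begin-strict
    entry π (suc (suc j)) ≡⟨ entry-insertAt-> j j ≤-refl ⟩
    entry σ (suc j)       <⟨ σ<x (suc j) ⟩
    x                     ≡⟨ entry-insertAt-suc j j≤|σ| ⟨
    entry π (suc j)       ∎)
    where open ≤-Reasoning

  peak-above : (i : ℕ) → 2 + j ≤ i → HasPeak π (suc i) ⇔ HasPeak σ i
  peak-above (suc (suc i)) (s≤s (s≤s j≤i)) = HasPeak-local {π} {σ}
    (mk⇔ (λ _ → s≤s (s≤s z≤n)) (λ _ → s≤s (s≤s z≤n)))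
    (mk⇔ (λ i+1<|π| → ≤-pred (subst (_ ≤_) |π|≡ i+1<|π|))
         (λ i+1≤|σ| → subst (_ ≤_) (sym |π|≡) (s≤s i+1≤|σ|)))
    (entry-insertAt-> j i j≤i)
    (entry-insertAt-> j (suc i) (m≤n⇒m≤1+n j≤i))
    (entry-insertAt-> j (suc (i + 1)) (≤-trans j≤i (≤-trans (m≤m+n i 1) (n≤1+n (i + 1)))))

infix 4 _≐_ _≐_below_ _≐_from_

_≐_ : (ℕ → Set) → List ℕ → Set
P ≐ T = ∀ i → P i ⇔ i ∈ T

_≐_below_ : (ℕ → Set) → List ℕ → ℕ → Set
P ≐ T below c = ∀ i → i < c → P i ⇔ i ∈ T

_≐_from_ : (ℕ → Set) → List ℕ → ℕ → Set
P ≐ T from c = ∀ i → c ≤ i → P i ⇔ i ∈ T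

∈-peakSet : (π : List ℕ) (i : ℕ) → i ∈ peakSet π ⇔ HasPeak π i
∈-peakSet π i = mk⇔ (proj₂ ∘ ∈-filter⁻ (hasPeak? π) {xs = upTo (suc (length π))})
  (λ peak@(_ , i+1≤|π| , _) → ∈-filter⁺ (hasPeak? π) (∈-upTo⁺ (s≤s (≤-trans (m≤m+n i 1) i+1≤|π|))) peak)

InPT⇔≐ : {T : List ℕ} {q : ℕ} {π : List ℕ} → IsPerm q π → InPT T q π ⇔ (HasPeak π ≐ T)
InPT⇔≐ {T} {q} {π} π-perm = mk⇔
  (λ (_ , peaks⊆T , T⊆peaks) i → mk⇔ (All.lookup peaks⊆T ∘ Equivalence.from (∈-peakSet π i))
                                    (Equivalence.to (∈-peakSet π i) ∘ All.lookup T⊆peaks))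
  (λ agree → π-perm , All.tabulate (λ {i} → Equivalence.to (agree i) ∘ Equivalence.to (∈-peakSet π i))
                    , All.tabulate (λ {i} → Equivalence.from (∈-peakSet π i) ∘ Equivalence.from (agree i)))

≐-cong : {P Q : ℕ → Set} {T : List ℕ} → (∀ i → P i ⇔ Q i) → (P ≐ T) ⇔ (Q ≐ T)
≐-cong P⇔Q = mk⇔ (λ agree i → ⇔-trans (⇔-sym (P⇔Q i)) (agree i)) (λ agree i → ⇔-trans (P⇔Q i) (agree i))

≐⇔≐from0 : {P : ℕ → Set} {T : List ℕ} → (P ≐ T) ⇔ (P ≐ T from 0)
≐⇔≐from0 = mk⇔ (λ agree i _ → agree i) (λ agree i → agree i z≤n)

≐-split : {P : ℕ → Set} {c : ℕ} {A R : List ℕ} → All (_< c) A → All (c ≤_) R →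
          (P ≐ A ++ R) ⇔ ((P ≐ A below c) × (P ≐ R from c))
≐-split {P} {c} {A} {R} A<c c≤R = mk⇔
  (λ agree → (λ i i<c → ⇔-trans (agree i) (mk⇔ (below i<c ∘ ∈-++⁻ A) ∈-++⁺ˡ)) ,
             (λ i c≤i → ⇔-trans (agree i) (mk⇔ (above c≤i ∘ ∈-++⁻ A) (∈-++⁺ʳ A))))
  (λ (agree-below , agree-from) i → case i <? c of λ where
     (yes i<c) → ⇔-trans (agree-below i i<c) (mk⇔ ∈-++⁺ˡ (below i<c ∘ ∈-++⁻ A))
     (no  i≮c) → let c≤i = ≮⇒≥ i≮c in ⇔-trans (agree-from i c≤i) (mk⇔ (∈-++⁺ʳ A) (above c≤i ∘ ∈-++⁻ A)))
  where
  below : ∀ {i} → i < c → i ∈ A ⊎ i ∈ R → i ∈ A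
  below i<c (inj₁ i∈A) = i∈A
  below i<c (inj₂ i∈R) = contradiction (All.lookup c≤R i∈R) (<⇒≱ i<c)
  above : ∀ {i} → c ≤ i → i ∈ A ⊎ i ∈ R → i ∈ R
  above c≤i (inj₁ i∈A) = contradiction (All.lookup A<c i∈A) (≤⇒≯ c≤i)
  above c≤i (inj₂ i∈R) = i∈R

≐-from-peel : {P : ℕ → Set} {T : List ℕ} {c : ℕ} →
              (P ≐ T from c) ⇔ ((P c ⇔ c ∈ T) × (P ≐ T from suc c))
≐-from-peel {c = c} = mk⇔ (λ agree → agree c ≤-refl , λ i c<i → agree i (<⇒≤ c<i))
  (λ (at-c , agree) i c≤i → case m≤n⇒m<n∨m≡n c≤i of λ where
     (inj₁ c<i)  → agree i c<i
     (inj₂ refl) → at-c)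

≐-from-suc : {P : ℕ → Set} {T : List ℕ} {c : ℕ} → (P c ⇔ c ∈ T) → (P ≐ T from c) ⇔ (P ≐ T from suc c)
≐-from-suc at-c = mk⇔ (proj₂ ∘ Equivalence.to ≐-from-peel)
                      (λ agree → Equivalence.from ≐-from-peel (at-c , agree))

≐-from-∷ : {P : ℕ → Set} {y : ℕ} {T : List ℕ} {c : ℕ} → y < c → (P ≐ y ∷ T from c) ⇔ (P ≐ T from c)
≐-from-∷ {y = y} {T} y<c = mk⇔ (λ agree i c≤i → ⇔-trans (agree i c≤i) (mk⇔ (drop-y c≤i) there))
                                (λ agree i c≤i → ⇔-trans (agree i c≤i) (mk⇔ there (drop-y c≤i)))
  where
  drop-y : ∀ {i} → _ ≤ i → i ∈ y ∷ T → i ∈ T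
  drop-y c≤i (here refl) = contradiction c≤i (<⇒≱ y<c)
  drop-y c≤i (there i∈T) = i∈T

≐-below-cong : {P Q : ℕ → Set} {T : List ℕ} {c : ℕ} → (∀ i → i < c → P i ⇔ Q i) →
               (P ≐ T below c) ⇔ (Q ≐ T below c)
≐-below-cong P⇔Q = mk⇔ (λ agree i i<c → ⇔-trans (⇔-sym (P⇔Q i i<c)) (agree i i<c))
                        (λ agree i i<c → ⇔-trans (P⇔Q i i<c) (agree i i<c))

∈-map-pred : {B : List ℕ} → All (1 ≤_) B → {i : ℕ} → i ∈ map (_∸ 1) B ⇔ suc i ∈ B
∈-map-pred 1≤B = mk⇔ to (∈-map⁺ (_∸ 1))
  where
  to : ∀ {i} → i ∈ map (_∸ 1) _ → suc i ∈ _
  to i∈ with ∈-map⁻ (_∸ 1) i∈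
  ... | suc b , b∈B , refl = b∈B
  ... | zero  , 0∈B , refl = contradiction (All.lookup 1≤B 0∈B) λ ()

≐-from-shift : {P Q : ℕ → Set} {B : List ℕ} {c : ℕ} → All (1 ≤_) B → (∀ i → c ≤ i → Q (suc i) ⇔ P i) →
               (Q ≐ B from suc c) ⇔ (P ≐ map (_∸ 1) B from c)
≐-from-shift 1≤B Q∘suc⇔P = mk⇔
  (λ agree i c≤i → ⇔-trans (⇔-sym (Q∘suc⇔P i c≤i))
                            (⇔-trans (agree (suc i) (s≤s c≤i)) (⇔-sym (∈-map-pred 1≤B))))
  (λ { agree (suc i) (s≤s c≤i) → ⇔-trans (Q∘suc⇔P i c≤i) (⇔-trans (agree i c≤i) (∈-map-pred 1≤B)) })

⇔-present : {A B : Set} → B → (A ⇔ B) ⇔ A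
⇔-present b = mk⇔ (λ A⇔B → Equivalence.from A⇔B b) (λ a → mk⇔ (λ _ → b) (λ _ → a))

⇔-absent : {A B : Set} → ¬ B → (A ⇔ B) ⇔ (¬ A)
⇔-absent ¬b = mk⇔ (λ A⇔B → ¬b ∘ Equivalence.to A⇔B) (λ ¬a → mk⇔ (⊥-elim ∘ ¬a) (⊥-elim ∘ ¬b))

drop-entry : (k : ℕ) (xs : List ℕ) → k < length xs → drop k xs ≡ entry xs (suc k) ∷ drop (suc k) xs
drop-entry zero    (x ∷ xs) _          = refl
drop-entry (suc k) (x ∷ xs) (s≤s k<|xs|) = drop-entry k xs k<|xs|

take-entry : (k : ℕ) (xs : List ℕ) → k < length xs → take (suc k) xs ≡ take k xs ++ [ entry xs (suc k) ]
take-entry zero    (x ∷ xs) _          = refl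
take-entry (suc k) (x ∷ xs) (s≤s k<|xs|) = cong (x ∷_) (take-entry k xs k<|xs|)

applyUpTo-entry : (f : ℕ → A) (xs : List ℕ) → applyUpTo (f ∘ entry xs ∘ suc) (length xs) ≡ map f xs
applyUpTo-entry f []       = refl
applyUpTo-entry f (x ∷ xs) = cong (f x ∷_) (applyUpTo-entry f xs)

map-entry-upTo : (f : ℕ → A) (xs : List ℕ) → map (f ∘ entry xs ∘ suc) (upTo (length xs)) ≡ map f xs
map-entry-upTo f xs = trans (map-applyUpTo id (f ∘ entry xs ∘ suc) (length xs)) (applyUpTo-entry f xs)

map-range1 : (f : ℕ → A) (n : ℕ) → map f (range1 n) ≡ map (f ∘ suc) (upTo n)
map-range1 f n = sym (map-∘ (upTo n))

sum-map-upTo-shift : (f : ℕ → ℕ) (n : ℕ) → f 0 + sum (map (f ∘ suc) (upTo n)) ≡ sum (map f (upTo n)) + f n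
sum-map-upTo-shift f n = begin
  f 0 + sum (map (f ∘ suc) (upTo n))    ≡⟨ cong (λ fs → f 0 + sum fs) (map-applyUpTo id (f ∘ suc) n) ⟩
  sum (applyUpTo f (suc n))             ≡⟨ cong sum (applyUpTo-∷ʳ f n) ⟨
  sum (applyUpTo f n ++ [ f n ])        ≡⟨ sum-++ (applyUpTo f n) [ f n ] ⟩
  sum (applyUpTo f n) + (f n + 0)       ≡⟨ cong₂ _+_ (cong sum (map-applyUpTo id f n))
                                                     (sym (+-identityʳ (f n))) ⟨
  sum (map f (upTo n)) + f n            ∎
  where open ≡-Reasoning

shiftSet-length : (S : List ℕ) → shiftSet S (suc (length S)) ≡ S
shiftSet-length S = trans (cong₂ (λ xs ys → xs ++ map (_∸ 1) ys) (take-all _ S ≤-refl) (drop-all _ S ≤-refl))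
                          (++-identityʳ S)

AllPairs-++-∷⁻ : {R : ℕ → ℕ → Set} (A : List ℕ) {x : ℕ} {B : List ℕ} → AllPairs R (A ++ x ∷ B) →
                 All (λ a → R a x) A × All (R x) B
AllPairs-++-∷⁻ []      (Rx ∷ _)      = [] , Rx
AllPairs-++-∷⁻ (a ∷ A) (Ra ∷ pairs) =
  let RA , RB = AllPairs-++-∷⁻ A pairs in All.lookup Ra (∈-++⁺ʳ A (here refl)) ∷ RA , RB

∈-middle : (A : List ℕ) {x : ℕ} {B S : List ℕ} → S ≡ A ++ x ∷ B → x ∈ S
∈-middle A refl = ∈-++⁺ʳ A (here refl)

Sparse : List ℕ → Set
Sparse = AllPairs (λ a b → 2 + a ≤ b)

telescoped-sum : (a z H T T' : ℕ) → a + T' ≡ T + z → a + (z + (H + T + T')) ≡ 2 * z + 2 * T + H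
telescoped-sum a z H T T' a+T'≡T+z = begin
  a + (z + (H + T + T'))  ≡⟨ solve 5 (λ a z H T T' → a :+ (z :+ (H :+ T :+ T')) := z :+ H :+ T :+ (a :+ T'))
                                    refl a z H T T' ⟩
  z + H + T + (a + T')    ≡⟨ cong (z + H + T +_) a+T'≡T+z ⟩
  z + H + T + (T + z)     ≡⟨ solve 3 (λ z H T → z :+ H :+ T :+ (T :+ z) := con 2 :* z :+ con 2 :* T :+ H)
                                    refl z H T ⟩
  2 * z + 2 * T + H       ∎
  where
  open ≡-Reasoning
  open +-*-Solver

module InsertingMaximum {q : ℕ} {σ : List ℕ} (σ-perm : IsPerm q σ) where

  private
    |σ|≡q : length σ ≡ q
    |σ|≡q = proj₁ σ-perm

    σ<1+q : ∀ i → entry σ i < suc q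
    σ<1+q i = s≤s (entry-≤ σ i (All.map proj₂ (proj₁ (proj₂ σ-perm))))

    module Peaks {j : ℕ} (j≤q : j ≤ q) =
      PeaksOfInsertedMaximum {σ} {suc q} {j} (subst (j ≤_) (sym |σ|≡q) j≤q) σ<1+q

  peaks-front : {S : List ℕ} → All (2 ≤_) S →
                (HasPeak (insertAt 0 (suc q) σ) ≐ S) ⇔ (HasPeak σ ≐ map (_∸ 1) S)
  peaks-front {S} 2≤S = begin
    (HasPeak π ≐ S)                     ∼⟨ ≐⇔≐from0 ⟩
    (HasPeak π ≐ S from 0)              ∼⟨ ≐-from-suc (mk⇔ (⊥-elim ∘ no-peak-at-0 π) (⊥-elim ∘ 0∉S)) ⟩
    (HasPeak π ≐ S from 1)              ∼⟨ ≐-from-shift (All.map (≤-trans (s≤s z≤n)) 2≤S) shifted ⟩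
    (HasPeak σ ≐ map (_∸ 1) S from 0)   ∼⟨ ⇔-sym ≐⇔≐from0 ⟩
    (HasPeak σ ≐ map (_∸ 1) S)          ∎
    where
    open Related.EquationalReasoning
    π : List ℕ
    π = insertAt 0 (suc q) σ
    0∉S : 0 ∉ S
    0∉S 0∈S = contradiction (All.lookup 2≤S 0∈S) λ ()
    shifted : ∀ i → 0 ≤ i → HasPeak π (suc i) ⇔ HasPeak σ i
    shifted zero          _ = mk⇔ (⊥-elim ∘ no-peak-at-1 π) (⊥-elim ∘ no-peak-at-0 σ)
    shifted (suc zero)    _ = mk⇔ (⊥-elim ∘ Peaks.no-peak-after z≤n) (⊥-elim ∘ no-peak-at-1 σ)
    shifted (suc (suc i)) _ = Peaks.peak-above z≤n (suc (suc i)) (s≤s (s≤s z≤n))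

  peaks-back : ∀ i → HasPeak (insertAt q (suc q) σ) i ⇔ HasPeak σ i
  peaks-back i with i <? q
  ... | yes i<q = Peaks.peak-below ≤-refl i i<q
  ... | no  i≮q with m≤n⇒m<n∨m≡n (≮⇒≥ i≮q)
  ...   | inj₂ refl = mk⇔ (⊥-elim ∘ Peaks.no-peak-before ≤-refl)
                          (⊥-elim ∘ no-peak-beyond σ (≤-reflexive |σ|≡q))
  ...   | inj₁ q<i  = mk⇔ (⊥-elim ∘ no-peak-beyond (insertAt q (suc q) σ) (subst (_≤ i) (sym |π|≡) q<i))
                          (⊥-elim ∘ no-peak-beyond σ (subst (_≤ i) (sym |σ|≡q) (<⇒≤ q<i)))
    where
    |π|≡ : length (insertAt q (suc q) σ) ≡ suc q
    |π|≡ = trans (length-insertAt q (suc q) σ) (cong suc |σ|≡q)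

  module Middle {j : ℕ} (1≤j : 1 ≤ j) (j<q : j < q)
                {A B : List ℕ} (A<j : All (_< j) A) (3+j≤B : All (3 + j ≤_) B) where

    private
      π : List ℕ
      π = insertAt j (suc q) σ

      B' : List ℕ
      B' = map (_∸ 1) B

      2+j≤B' : All (2 + j ≤_) B'
      2+j≤B' = All-map⁺ (All.map (∸-monoˡ-≤ 1) 3+j≤B)

      open Peaks (<⇒≤ j<q)

      Core : Set
      Core = (HasPeak σ ≐ A below j) × (HasPeak σ ≐ B' from 2 + j)

      below-2+j : ∀ {i} {T : List ℕ} → i < 2 + j → All (2 + j ≤_) T → i ∉ T
      below-2+j i<2+j 2+j≤T i∈T = <⇒≱ i<2+j (All.lookup 2+j≤T i∈T)

    peaks-π-above : (HasPeak π ≐ suc j ∷ B from j) ⇔ (HasPeak σ ≐ B' from 2 + j)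
    peaks-π-above = begin
      (HasPeak π ≐ suc j ∷ B from j)        ∼⟨ ≐-from-suc (mk⇔ (⊥-elim ∘ no-peak-before) (⊥-elim ∘ j∉)) ⟩
      (HasPeak π ≐ suc j ∷ B from suc j)    ∼⟨ ≐-from-suc (mk⇔ (λ _ → here refl) (λ _ → peak-at 1≤j j<|σ|)) ⟩
      (HasPeak π ≐ suc j ∷ B from 2 + j)    ∼⟨ ≐-from-∷ ≤-refl ⟩
      (HasPeak π ≐ B from 2 + j)            ∼⟨ ≐-from-suc (mk⇔ (⊥-elim ∘ no-peak-after) (⊥-elim ∘ 2+j∉B)) ⟩
      (HasPeak π ≐ B from 3 + j)            ∼⟨ ≐-from-shift (All.map (≤-trans (s≤s z≤n)) 3+j≤B) peak-above ⟩
      (HasPeak σ ≐ B' from 2 + j)           ∎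
      where
      open Related.EquationalReasoning
      j<|σ| : j < length σ
      j<|σ| = subst (j <_) (sym |σ|≡q) j<q
      j∉ : j ∉ suc j ∷ B
      j∉ (here j≡1+j) = <-irrefl j≡1+j (n<1+n j)
      j∉ (there j∈B)  = <⇒≱ (≤-trans (n≤1+n _) (n≤1+n _)) (All.lookup 3+j≤B j∈B)
      2+j∉B : 2 + j ∉ B
      2+j∉B 2+j∈B = <⇒≱ ≤-refl (All.lookup 3+j≤B 2+j∈B)

    peaks-π : (HasPeak π ≐ A ++ suc j ∷ B) ⇔ Core
    peaks-π = ⇔-trans (≐-split A<j (n≤1+n j ∷ All.map (≤-trans (m≤n+m j 3)) 3+j≤B))
                      (≐-below-cong peak-below ×-⇔ peaks-π-above)

    peaks-σ : {R : List ℕ} → All (j ≤_) R → (HasPeak σ ≐ R from 2 + j) ⇔ (HasPeak σ ≐ B' from 2 + j) →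
      (HasPeak σ ≐ A ++ R) ⇔ (Core × (HasPeak σ j ⇔ j ∈ R) × (HasPeak σ (suc j) ⇔ suc j ∈ R))
    peaks-σ j≤R R≐B' = ⇔-trans (≐-split A<j j≤R)
      (⇔-trans (⇔-refl ×-⇔ ⇔-trans ≐-from-peel (⇔-refl ×-⇔ ⇔-trans ≐-from-peel (⇔-refl ×-⇔ R≐B')))
               (mk⇔ (λ (below , at-j , at-1+j , above) → (below , above) , at-j , at-1+j)
                    (λ ((below , above) , at-j , at-1+j) → below , at-j , at-1+j , above)))

    𝟙-middle : 𝟙 (inPT? (A ++ suc j ∷ B) (suc q) π)
             ≡ 𝟙 (inPT? (A ++ B') q σ) + 𝟙 (inPT? (A ++ j ∷ B') q σ) + 𝟙 (inPT? (A ++ suc j ∷ B') q σ)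
    𝟙-middle = begin
      𝟙 e?                                    ≡⟨ 𝟙-cong E⇔Core e? core? ⟩
      𝟙 core?                                 ≡⟨ 𝟙-split₃ core? a? b? (no-adjacent-peaks σ) ⟩
      𝟙 (core? ×-dec ¬? a? ×-dec ¬? b?) + 𝟙 (core? ×-dec a? ×-dec ¬? b?) + 𝟙 (core? ×-dec ¬? a? ×-dec b?)
        ≡⟨ cong₂ _+_ (cong₂ _+_ (𝟙-cong (⇔-sym neither) (core? ×-dec ¬? a? ×-dec ¬? b?) (inPT? (A ++ B') q σ))
                                (𝟙-cong (⇔-sym only-j) (core? ×-dec a? ×-dec ¬? b?) (inPT? (A ++ j ∷ B') q σ)))
                     (𝟙-cong (⇔-sym only-1+j) (core? ×-dec ¬? a? ×-dec b?) (inPT? (A ++ suc j ∷ B') q σ)) ⟩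
      𝟙 (inPT? (A ++ B') q σ) + 𝟙 (inPT? (A ++ j ∷ B') q σ) + 𝟙 (inPT? (A ++ suc j ∷ B') q σ) ∎
      where
      open ≡-Reasoning
      e? : Dec (InPT (A ++ suc j ∷ B) (suc q) π)
      e? = inPT? (A ++ suc j ∷ B) (suc q) π
      a? : Dec (HasPeak σ j)
      a? = hasPeak? σ j
      b? : Dec (HasPeak σ (suc j))
      b? = hasPeak? σ (suc j)
      E⇔Core : InPT (A ++ suc j ∷ B) (suc q) π ⇔ Core
      E⇔Core = ⇔-trans (InPT⇔≐ (IsPerm-insertAt j σ-perm)) peaks-π
      core? : Dec Core
      core? = Dec-map E⇔Core e?
      j≤B' : All (j ≤_) B'
      j≤B' = All.map (≤-trans (≤-trans (n≤1+n j) (n≤1+n (suc j)))) 2+j≤B'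
      j∉B' : j ∉ B'
      j∉B' = below-2+j (≤-trans (n≤1+n (suc j)) ≤-refl) 2+j≤B'
      1+j∉B' : suc j ∉ B'
      1+j∉B' = below-2+j ≤-refl 2+j≤B'
      neither : InPT (A ++ B') q σ ⇔ (Core × ¬ HasPeak σ j × ¬ HasPeak σ (suc j))
      neither = ⇔-trans (InPT⇔≐ σ-perm)
        (⇔-trans (peaks-σ j≤B' (⇔-refl)) (⇔-refl ×-⇔ ⇔-absent j∉B' ×-⇔ ⇔-absent 1+j∉B'))
      only-j : InPT (A ++ j ∷ B') q σ ⇔ (Core × HasPeak σ j × ¬ HasPeak σ (suc j))
      only-j = ⇔-trans (InPT⇔≐ σ-perm)
        (⇔-trans (peaks-σ (≤-refl ∷ j≤B') (≐-from-∷ (≤-trans (n≤1+n (suc j)) ≤-refl)))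
                 (⇔-refl ×-⇔ ⇔-present (here refl) ×-⇔ ⇔-absent (λ { (here 1+j≡j) → <-irrefl (sym 1+j≡j) (n<1+n j)
                                                                      ; (there 1+j∈B') → 1+j∉B' 1+j∈B' })))
      only-1+j : InPT (A ++ suc j ∷ B') q σ ⇔ (Core × ¬ HasPeak σ j × HasPeak σ (suc j))
      only-1+j = ⇔-trans (InPT⇔≐ σ-perm)
        (⇔-trans (peaks-σ (n≤1+n j ∷ j≤B') (≐-from-∷ ≤-refl))
                 (⇔-refl ×-⇔ ⇔-absent (λ { (here j≡1+j) → <-irrefl j≡1+j (n<1+n j)
                                              ; (there j∈B') → j∉B' j∈B' }) ×-⇔ ⇔-present (here refl)))

  𝟙-front : {S : List ℕ} → All (2 ≤_) S →
            𝟙 (inPT? S (suc q) (insertAt 0 (suc q) σ)) ≡ 𝟙 (inPT? (map (_∸ 1) S) q σ)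
  𝟙-front 2≤S = 𝟙-cong (⇔-trans (InPT⇔≐ (IsPerm-insertAt 0 σ-perm))
                                (⇔-trans (peaks-front 2≤S) (⇔-sym (InPT⇔≐ σ-perm))))
                       (inPT? _ (suc q) _) (inPT? _ q σ)

  𝟙-back : {S : List ℕ} → 𝟙 (inPT? S (suc q) (insertAt q (suc q) σ)) ≡ 𝟙 (inPT? S q σ)
  𝟙-back = 𝟙-cong (⇔-trans (InPT⇔≐ (IsPerm-insertAt q σ-perm))
                           (⇔-trans (≐-cong peaks-back) (⇔-sym (InPT⇔≐ σ-perm))))
                  (inPT? _ (suc q) _) (inPT? _ q σ)

  𝟙-unlisted-peak : {S : List ℕ} {j : ℕ} → 1 ≤ j → j < q → suc j ∉ S →
                    𝟙 (inPT? S (suc q) (insertAt j (suc q) σ)) ≡ 0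
  𝟙-unlisted-peak {S} {j} 1≤j j<q 1+j∉S = 𝟙-¬
    (λ π∈ → 1+j∉S (Equivalence.to (Equivalence.to (InPT⇔≐ (IsPerm-insertAt j σ-perm)) π∈ (suc j))
                    (Peaks.peak-at (<⇒≤ j<q) 1≤j (subst (j <_) (sym |σ|≡q) j<q))))
    (inPT? S (suc q) (insertAt j (suc q) σ))

  module _ {S : List ℕ} (2≤S : All (2 ≤_) S) (S≤q : All (_≤ q) S) (sparse : Sparse S) where

    private
      h : ℕ → ℕ
      h j = 𝟙 (inPT? S (suc q) (insertAt j (suc q) σ))

      -- indexed by k = ℓ - 1, so that i_ℓ = entry S (suc k)

      shifted hatted : ℕ → ℕ
      shifted k = 𝟙 (inPT? (shiftSet S (suc k)) q σ)
      hatted  k = 𝟙 (inPT? (shiftSetHat S (suc k)) q σ)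

    𝟙-insert-at-peak : (A : List ℕ) (x : ℕ) (B : List ℕ) → S ≡ A ++ x ∷ B →
      h (x ∸ 1) ≡ 𝟙 (inPT? (A ++ map (_∸ 1) B) q σ) + 𝟙 (inPT? (A ++ map (_∸ 1) (x ∷ B)) q σ)
                  + 𝟙 (inPT? ((A ++ [ x ]) ++ map (_∸ 1) B) q σ)
    𝟙-insert-at-peak A zero          B S≡ = contradiction (All.lookup 2≤S (∈-middle A S≡)) λ ()
    𝟙-insert-at-peak A (suc zero)    B S≡ = contradiction (All.lookup 2≤S (∈-middle A S≡)) λ { (s≤s ()) }
    𝟙-insert-at-peak A (suc (suc i)) B S≡ = begin
      h (suc i)                                                ≡⟨ cong (λ T → 𝟙 (inPT? T (suc q) π)) S≡ ⟩
      𝟙 (inPT? (A ++ suc (suc i) ∷ B) (suc q) π)               ≡⟨ Middle.𝟙-middle (s≤s z≤n) j<q A<j 3+j≤B ⟩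
      n₁ + n₂ + 𝟙 (inPT? (A ++ suc (suc i) ∷ B') q σ)          ≡⟨ cong (λ T → n₁ + n₂ + 𝟙 (inPT? T q σ))
                                                                       (++-assoc A [ suc (suc i) ] B') ⟨
      n₁ + n₂ + 𝟙 (inPT? ((A ++ [ suc (suc i) ]) ++ B') q σ)   ∎
      where
      open ≡-Reasoning
      π B' : List ℕ
      π = insertAt (suc i) (suc q) σ
      B' = map (_∸ 1) B
      n₁ n₂ : ℕ
      n₁ = 𝟙 (inPT? (A ++ B') q σ)
      n₂ = 𝟙 (inPT? (A ++ suc i ∷ B') q σ)
      j<q : suc i < q
      j<q = All.lookup S≤q (∈-middle A S≡)
      around-x : All (λ a → 2 + a ≤ suc (suc i)) A × All (4 + i ≤_) B
      around-x = AllPairs-++-∷⁻ A (subst Sparse S≡ sparse)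
      A<j : All (_< suc i) A
      A<j = All.map ≤-pred (proj₁ around-x)
      3+j≤B : All (3 + suc i ≤_) B
      3+j≤B = proj₂ around-x

    𝟙-insert-at-entry : (k : ℕ) → k < length S →
                        h (entry S (suc k) ∸ 1) ≡ hatted k + shifted k + shifted (suc k)
    𝟙-insert-at-entry k k<|S| = begin
      h (x ∸ 1)                                         ≡⟨ 𝟙-insert-at-peak pre x post S≡ ⟩
      hatted k + 𝟙 (inPT? (pre ++ map (_∸ 1) (x ∷ post)) q σ)
               + 𝟙 (inPT? ((pre ++ [ x ]) ++ map (_∸ 1) post) q σ)
        ≡⟨ cong₂ (λ T T′ → hatted k + 𝟙 (inPT? (pre ++ map (_∸ 1) T) q σ)
                                    + 𝟙 (inPT? (T′ ++ map (_∸ 1) post) q σ))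
                 (sym drop≡) (sym (take-entry k S k<|S|)) ⟩
      hatted k + shifted k + shifted (suc k)            ∎
      where
      open ≡-Reasoning
      x : ℕ
      x = entry S (suc k)
      pre post : List ℕ
      pre = take k S
      post = drop (suc k) S
      drop≡ : drop k S ≡ x ∷ post
      drop≡ = drop-entry k S k<|S|
      S≡ : S ≡ pre ++ x ∷ post
      S≡ = trans (sym (take++drop≡id k S)) (cong (pre ++_) drop≡)

    -- Only the two ends and the positions i_ℓ - 1 (counted from 0) can produce the peak set S.
    sum-insertions-support : 1 ≤ q → sum (map h (upTo (suc q))) ≡ h 0 + (h q + sum (map (h ∘ (_∸ 1)) S))
    sum-insertions-support 1≤q = begin
      sum (map h (upTo (suc q)))                      ≡⟨ sum-map-support _≟_ h (Unique.upTo⁺ (suc q)) unique ⊆upTo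
                                                                          (All.tabulate vanishes) ⟩
      h 0 + (h q + sum (map h (map (_∸ 1) S)))       ≡⟨ cong (λ t → h 0 + (h q + sum t)) (map-∘ S) ⟨
      h 0 + (h q + sum (map (h ∘ (_∸ 1)) S))         ∎
      where
      open ≡-Reasoning
      pred-S-bounded : All (λ y → 1 ≤ y × y < q) (map (_∸ 1) S)
      pred-S-bounded = All-map⁺ (All.zipWith (λ (2≤x , x≤q) → pred-bounded 2≤x x≤q) (2≤S , S≤q))
        where
        pred-bounded : ∀ {x} → 2 ≤ x → x ≤ q → 1 ≤ x ∸ 1 × x ∸ 1 < q
        pred-bounded (s≤s (s≤s z≤n)) x≤q = s≤s z≤n , x≤q
      unique : Unique (0 ∷ q ∷ map (_∸ 1) S)
      unique = ((λ 0≡q → <-irrefl 0≡q 1≤q) ∷ All.map (λ (1≤y , _) 0≡y → <-irrefl 0≡y 1≤y) pred-S-bounded)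
             ∷ All.map (λ (_ , y<q) q≡y → <-irrefl (sym q≡y) y<q) pred-S-bounded
             ∷ AllPairs-map⁺ (AllPairs.map (λ {a} 2+a≤b → <⇒≢ (≤-trans (s≤s (m∸n≤m a 1)) (∸-monoˡ-≤ 1 2+a≤b)))
                                           sparse)
      ⊆upTo : ∀ {z} → z ∈ 0 ∷ q ∷ map (_∸ 1) S → z ∈ upTo (suc q)
      ⊆upTo (here refl)         = ∈-upTo⁺ (s≤s z≤n)
      ⊆upTo (there (here refl)) = ∈-upTo⁺ ≤-refl
      ⊆upTo (there (there z∈))  = ∈-upTo⁺ (m<n⇒m<1+n (proj₂ (All.lookup pred-S-bounded z∈)))
      vanishes : ∀ {j} → j ∈ upTo (suc q) → j ∉ 0 ∷ q ∷ map (_∸ 1) S → h j ≡ 0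
      vanishes {zero}  _  j∉ = contradiction (here refl) j∉
      vanishes {suc j} j∈ j∉ with m≤n⇒m<n∨m≡n (≤-pred (∈-upTo⁻ j∈))
      ... | inj₂ refl  = contradiction (there (here refl)) j∉
      ... | inj₁ 1+j<q = 𝟙-unlisted-peak (s≤s z≤n) 1+j<q (λ 2+j∈S → j∉ (there (there (∈-map⁺ (_∸ 1) 2+j∈S))))

    sum-insertions : 1 ≤ q → sum (map h (upTo (suc q)))
      ≡ 2 * 𝟙 (inPT? S q σ)
        + 2 * sum (map (λ ℓ → 𝟙 (inPT? (shiftSet S ℓ) q σ)) (range1 (length S)))
        + sum (map (λ ℓ → 𝟙 (inPT? (shiftSetHat S ℓ) q σ)) (range1 (length S)))
    sum-insertions 1≤q = begin
      sum (map h (upTo (suc q)))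
        ≡⟨ sum-insertions-support 1≤q ⟩
      h 0 + (h q + sum (map (h ∘ (_∸ 1)) S))
        ≡⟨ cong₂ _+_ (𝟙-front 2≤S) (cong₂ _+_ 𝟙-back at-peaks) ⟩
      shifted 0 + (z + (H + Sh + Sh′))
        ≡⟨ telescoped-sum (shifted 0) z H Sh Sh′ telescope ⟩
      2 * z + 2 * Sh + H
        ≡⟨ cong₂ (λ a b → 2 * z + 2 * a + b) (cong sum (map-range1 _ s)) (cong sum (map-range1 _ s)) ⟨
      2 * z + 2 * sum (map (λ ℓ → 𝟙 (inPT? (shiftSet S ℓ) q σ)) (range1 s))
        + sum (map (λ ℓ → 𝟙 (inPT? (shiftSetHat S ℓ) q σ)) (range1 s))
        ∎
      where
      open ≡-Reasoning
      s z H Sh Sh′ : ℕ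
      s = length S
      z = 𝟙 (inPT? S q σ)
      H = sum (map hatted (upTo s))
      Sh = sum (map shifted (upTo s))
      Sh′ = sum (map (shifted ∘ suc) (upTo s))
      at-peaks : sum (map (h ∘ (_∸ 1)) S) ≡ H + Sh + Sh′
      at-peaks = begin
        sum (map (h ∘ (_∸ 1)) S)
          ≡⟨ cong sum (map-entry-upTo (h ∘ (_∸ 1)) S) ⟨
        sum (map (h ∘ (_∸ 1) ∘ entry S ∘ suc) (upTo s))
          ≡⟨ sum-map-cong (All.tabulate (λ k∈ → 𝟙-insert-at-entry _ (∈-upTo⁻ k∈))) ⟩
        sum (map (λ k → hatted k + shifted k + shifted (suc k)) (upTo s))
          ≡⟨ sum-map-+ (λ k → hatted k + shifted k) (shifted ∘ suc) (upTo s) ⟩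
        sum (map (λ k → hatted k + shifted k) (upTo s)) + Sh′
          ≡⟨ cong (_+ Sh′) (sum-map-+ hatted shifted (upTo s)) ⟩
        H + Sh + Sh′
          ∎
      telescope : shifted 0 + Sh′ ≡ Sh + z
      telescope = trans (sum-map-upTo-shift shifted s) (cong (λ T → Sh + 𝟙 (inPT? T q σ)) (shiftSet-length S))

countPT-recurrence : {S : List ℕ} {q : ℕ} → 1 ≤ q → All (2 ≤_) S → All (_≤ q) S → Sparse S →
  countPT S (suc q) ≡ 2 * countPT S q
                      + 2 * sum (map (λ ℓ → countPT (shiftSet S ℓ) q) (range1 (length S)))
                      + sum (map (λ ℓ → countPT (shiftSetHat S ℓ) q) (range1 (length S)))
countPT-recurrence {S} {q} 1≤q 2≤S S≤q sparse = begin
  countPT S (suc q)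
    ≡⟨ countPT-suc S q ⟩
  sum (map (λ σ → sum (map (λ j → 𝟙 (inPT? S (suc q) (insertAt j (suc q) σ))) (upTo (suc q)))) (perms q))
    ≡⟨ sum-map-cong (All.tabulate (λ σ∈ →
         InsertingMaximum.sum-insertions (IsPerm-perms q σ∈) 2≤S S≤q sparse 1≤q)) ⟩
  sum (map (λ σ → 2 * z σ + 2 * sh σ + hat σ) (perms q))
    ≡⟨ sum-map-+ (λ σ → 2 * z σ + 2 * sh σ) hat (perms q) ⟩
  sum (map (λ σ → 2 * z σ + 2 * sh σ) (perms q)) + sum (map hat (perms q))
    ≡⟨ cong (_+ sum (map hat (perms q))) (sum-map-+ (λ σ → 2 * z σ) (λ σ → 2 * sh σ) (perms q)) ⟩
  sum (map (λ σ → 2 * z σ) (perms q)) + sum (map (λ σ → 2 * sh σ) (perms q)) + sum (map hat (perms q))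
    ≡⟨ cong₂ (λ a b → a + b + sum (map hat (perms q))) (sum-map-*ˡ 2 z (perms q)) (sum-map-*ˡ 2 sh (perms q)) ⟩
  2 * sum (map z (perms q)) + 2 * sum (map sh (perms q)) + sum (map hat (perms q))
    ≡⟨ cong₂ _+_ (cong₂ (λ a b → 2 * a + 2 * b) (sym (countPT≡sum-perms S q))
                                                (sum-perms≡sum-countPT (shiftSet S) q L))
                 (sum-perms≡sum-countPT (shiftSetHat S) q L) ⟩
  2 * countPT S q + 2 * sum (map (λ ℓ → countPT (shiftSet S ℓ) q) L)
    + sum (map (λ ℓ → countPT (shiftSetHat S ℓ) q) L)
    ∎
  where
  open ≡-Reasoning
  L : List ℕ
  L = range1 (length S)
  z sh hat : List ℕ → ℕ
  z σ = 𝟙 (inPT? S q σ)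
  sh σ = sum (map (λ ℓ → 𝟙 (inPT? (shiftSet S ℓ) q σ)) L)
  hat σ = sum (map (λ ℓ → 𝟙 (inPT? (shiftSetHat S ℓ) q σ)) L)

peaks-sparse : {π S : List ℕ} → StrictlyIncreasing S → All (HasPeak π) S → Sparse S
peaks-sparse {π} inc peaks = Linked⇒AllPairs (λ 2+a≤b 2+b≤c → ≤-trans 2+a≤b (≤-trans (m≤n+m _ 2) 2+b≤c))
                                             (linked inc peaks)
  where
  linked : ∀ {S} → StrictlyIncreasing S → All (HasPeak π) S → Linked (λ a b → 2 + a ≤ b) S
  linked inc-[]              _                          = []
  linked inc-[x]             _                          = [-]
  linked (inc-∷ a<b inc) (a-peak ∷ b-peak ∷ peaks) with m≤n⇒m<n∨m≡n a<b
  ... | inj₁ 1+a<b  = 1+a<b ∷ linked inc (b-peak ∷ peaks)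
  ... | inj₂ refl   = contradiction (a-peak , b-peak) (no-adjacent-peaks π)

-- Admissibility is used only to see that the elements of S are pairwise non-adjacent peak positions.
theorem2 : (n : ℕ) → 1 ≤ n → (S : List ℕ) → StrictlyIncreasing S →
    All (λ i → (1 ≤ i) × (i ≤ suc n)) S → Admissible (suc n) S →
    (q : ℕ) → 1 ≤ q → All (λ i → i ≤ q) S →
    countPT S (suc q) ≡
      2 * countPT S q
      + 2 * sum (map (λ ℓ → countPT (shiftSet S ℓ) q) (range1 (length S)))
      + sum (map (λ ℓ → countPT (shiftSetHat S ℓ) q) (range1 (length S)))
theorem2 _ _ S inc _ (π , _ , _ , S⊆peaks) q 1≤q S≤q =
  countPT-recurrence 1≤q (All.map proj₁ peaks) S≤q (peaks-sparse {π} inc peaks)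
  where
  peaks : All (HasPeak π) S
  peaks = All.map (λ {i} → Equivalence.to (∈-peakSet π i)) S⊆peaks
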